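{- Let $G$ be a connected graph with $\mathrm{vol}(G)\ge 6$, and let $G'$ be obtained from $G$ by adding one edge $\{a,b\}$ with $a\ne b$ non-adjacent in $G$. Let $H$ be a connected graph with diameter $D_H$ and $|V(H)|=k\ge 2$. Then $$\frac{\lambda(G',H)}{\lambda(G,H)}\le \left(1+\frac{2}{\mathrm{vol}(G)}\right)(1+D_H^2)$$ and $$\frac{\lambda(G',H)}{\lambda(G,H)}\ge \left(1+\frac{2}{\mathrm{vol}(G)}\right)\max\left\{\frac{\mathrm{vol}(G)-1}{\mathrm{vol}(G)-1+D_H^2(2\,\mathrm{vol}(G)+1)},\ \frac14\right\}.$$
   Context: All graphs are finite and simple. For a graph $G$, $d_v$ denotes the degree of $v$, $u\sim v$ means adjacency, and $\mathrm{vol}(G)=\sum_v d_v$. For a metric space $(X,d)$ and $f:V(G)\to X$ set $R_f(G,X)=\frac{\mathrm{vol}(G)\sum_{u\sim v} d(f(u),f(v))^2}{\sum_{u,v} d(f(u),f(v))^2 d_u d_v}$, where the numerator sum is over edges of $G$ and the denominator sum over unordered pairs of vertices; $\lambda(G,X)=\inf_f R_f(G,X)$ over all $f$ with nonzero denominator. A connected graph $H$ is regarded as the metric space $(V(H),d_H)$ with shortest-path distance, and $\lambda(G,H)=\lambda(G,(V(H),d_H))$. -}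

module Defs where

open import Data.Nat as ℕ using (ℕ; zero; suc; _<_; _≤_)
open import Data.Fin using (Fin; zero; suc; toℕ; _≟_)
open import Data.Bool using (Bool; true; false; _∧_; _∨_; if_then_else_)
open import Data.Product using (Σ; _×_; _,_; ∃)
open import Data.Integer using (+_)
open import Data.Rational as ℚ using (ℚ; 0ℚ; 1ℚ)
open import Data.Rational.Properties as ℚP using ()
open import Relation.Nullary using (¬_; yes; no; does)
open import Relation.Binary.PropositionalEquality using (_≡_; _≢_)

record Graph (n : ℕ) : Set where
  field
    adj   : Fin n → Fin n → Bool
    sym   : ∀ u v → adj u v ≡ adj v u
    irrefl : ∀ u → adj u u ≡ false
open Graph public

sumFin : ∀ {n} → (Fin n → ℕ) → ℕ
sumFin {zero}  f = 0
sumFin {suc n} f = f zero ℕ.+ sumFin (λ i → f (suc i))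

-- sum over unordered pairs {u,v}, u ≠ v (taken as u < v)
sumPairs : ∀ {n} → (Fin n → Fin n → ℕ) → ℕ
sumPairs {n} f = sumFin λ u → sumFin λ v → if does (toℕ u ℕ.<? toℕ v) then f u v else 0

b2n : Bool → ℕ
b2n true  = 1
b2n false = 0

deg : ∀ {n} → Graph n → Fin n → ℕ
deg G u = sumFin λ v → b2n (adj G u v)

vol : ∀ {n} → Graph n → ℕ
vol G = sumFin (deg G)

data Walk {n} (G : Graph n) : Fin n → Fin n → ℕ → Set where
  here : ∀ {u} → Walk G u u 0
  step : ∀ {u w v l} → adj G u w ≡ true → Walk G w v l → Walk G u v (suc l)

Connected : ∀ {n} → Graph n → Set
Connected G = ∀ u v → ∃ λ l → Walk G u v l

eqB : ∀ {n} → Fin n → Fin n → Bool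
eqB u v = does (u ≟ v)

addEdgeAdj : ∀ {n} → Graph n → Fin n → Fin n → Fin n → Fin n → Bool
addEdgeAdj G a b u v = adj G u v ∨ ((eqB u a ∧ eqB v b) ∨ (eqB u b ∧ eqB v a))

anyFin : ∀ {n} → (Fin n → Bool) → Bool
anyFin {zero}  p = false
anyFin {suc n} p = p zero ∨ anyFin (λ i → p (suc i))

within : ∀ {k} → Graph k → ℕ → Fin k → Fin k → Bool
within H zero    u v = eqB u v
within H (suc t) u v = within H t u v ∨ anyFin (λ w → adj H u w ∧ within H t w v)

searchDist : ∀ {k} → Graph k → Fin k → Fin k → ℕ → ℕ → ℕ
searchDist H u v s zero    = s
searchDist H u v s (suc f) = if within H s u v then s else searchDist H u v (suc s) f

-- shortest-path distance d_H(u,v) (for connected H every distance is < k)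
dist : ∀ {k} → Graph k → Fin k → Fin k → ℕ
dist {k} H u v = searchDist H u v 0 k

maxFin : ∀ {n} → (Fin n → ℕ) → ℕ
maxFin {zero}  f = 0
maxFin {suc n} f = f zero ℕ.⊔ maxFin (λ i → f (suc i))

diameter : ∀ {k} → Graph k → ℕ
diameter H = maxFin λ u → maxFin λ v → dist H u v

toℚ : ℕ → ℚ
toℚ m = (+ m) ℚ./ 1

-- total division (x/0 := 0); only used where the divisor is nonzero
_÷ℚ_ : ℚ → ℚ → ℚ
p ÷ℚ q with q ℚP.≟ 0ℚ
... | yes _  = 0ℚ
... | no q≢0 = ℚ._÷_ p q {{ℚ.≢-nonZero q≢0}}

sq : ℕ → ℕ
sq x = x ℕ.* x

numer : ∀ {n k} → Graph n → Graph k → (Fin n → Fin k) → ℕ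
numer G H f = sumPairs λ u v → b2n (adj G u v) ℕ.* sq (dist H (f u) (f v))

denom : ∀ {n k} → Graph n → Graph k → (Fin n → Fin k) → ℕ
denom G H f = sumPairs λ u v → sq (dist H (f u) (f v)) ℕ.* (deg G u ℕ.* deg G v)

R : ∀ {n k} → Graph n → Graph k → (Fin n → Fin k) → ℚ
R G H f = toℚ (vol G ℕ.* numer G H f) ÷ℚ toℚ (denom G H f)

LowerBound : ∀ {n k} → Graph n → Graph k → ℚ → Set
LowerBound G H ℓ = ∀ f → denom G H f ≢ 0 → ℓ ℚ.≤ R G H f

IsLambda : ∀ {n k} → Graph n → Graph k → ℚ → Set
IsLambda G H ℓ = LowerBound G H ℓ × (∀ m → LowerBound G H m → m ℚ.≤ ℓ)

module Submission where

-- Let f₀ and g₀ be maps into H realising λ(G,H) and λ(G′,H); they exist because there are only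
-- finitely many maps.  Adding the edge {a,b} raises vol by 2 and the degrees of a and b by one,
-- adds one term of weight at most D_H² to the numerator of R_f, and increases the denominator by
-- at most D_H²(2 vol G + 1), and by at most a factor 4.  Testing λ(G′,H) with f₀ gives the upper
-- bound; testing λ(G,H) with g₀ gives the lower bounds, the first one because the denominator of
-- a non-constant map is at least vol G − 1: the two sides A, B ≥ 1 of the cut {f = f(u)} satisfy
-- A + B = vol G, and every crossing pair contributes to the denominator, so A B ≤ denominator.

open import Defs hiding (sym)
open import Data.Bool using (Bool; true; false; not; _∧_; _∨_; if_then_else_)
open import Data.Empty using (⊥-elim)
open import Data.Fin as F using (Fin; zero; suc; toℕ)
open import Data.Fin.Properties using (toℕ-injective)
open import Data.Integer as ℤ using (+≤+)
import Data.Integer.Properties as ℤP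
open import Data.Nat as ℕ using (ℕ; zero; suc; _+_; _*_; _∸_; _≤_; _<_; z≤n; s≤s)
open import Data.Nat.Properties
open import Data.Nat.Tactic.RingSolver using (solve-∀)
open import Data.Product using (Σ; ∃; _×_; _,_; proj₁; proj₂)
open import Data.Rational as ℚ using (ℚ; 0ℚ; 1ℚ; toℚᵘ; fromℚᵘ)
import Data.Rational.Properties as ℚP
open import Data.Rational.Unnormalised as ℚᵘ using (mkℚᵘ; *≡*; *≤*)
import Data.Rational.Unnormalised.Properties as ℚᵘP
open import Data.Sum using (_⊎_; inj₁; inj₂)
open import Data.Vec.Functional using (_∷_; head; tail)
open import Function using (_∘_)
open import Relation.Binary.Definitions using (tri<; tri≈; tri>)
open import Relation.Binary.PropositionalEquality
open import Relation.Nullary using (¬_; Dec; yes; no; does; ¬?)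
open import Relation.Nullary.Decidable using (dec-true; dec-false)
open import Algebra.Properties.Semiring.Sum +-*-semiring
  using (sum; ∑-distrib-+; ∑-comm; *-distribˡ-sum; *-distribʳ-sum)
open import Algebra.Properties.CommutativeSemigroup *-commutativeSemigroup
  using () renaming (interchange to *-interchange)

-- Finite sums

sumFin≡sum : ∀ {n} (f : Fin n → ℕ) → sumFin f ≡ sum f
sumFin≡sum {zero}  f = refl
sumFin≡sum {suc n} f = cong (f zero +_) (sumFin≡sum (f ∘ suc))

sumFin-cong : ∀ {n} {f g : Fin n → ℕ} → (∀ i → f i ≡ g i) → sumFin f ≡ sumFin g
sumFin-cong {zero}  f≗g = refl
sumFin-cong {suc n} f≗g = cong₂ _+_ (f≗g zero) (sumFin-cong (f≗g ∘ suc))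

sumFin-mono : ∀ {n} {f g : Fin n → ℕ} → (∀ i → f i ≤ g i) → sumFin f ≤ sumFin g
sumFin-mono {zero}  f≤g = z≤n
sumFin-mono {suc n} f≤g = +-mono-≤ (f≤g zero) (sumFin-mono (f≤g ∘ suc))

sumFin-distrib-+ : ∀ {n} (f g : Fin n → ℕ) → sumFin (λ i → f i + g i) ≡ sumFin f + sumFin g
sumFin-distrib-+ f g = begin
  sumFin (λ i → f i + g i) ≡⟨ sumFin≡sum (λ i → f i + g i) ⟩
  sum (λ i → f i + g i)    ≡⟨ ∑-distrib-+ f g ⟩
  sum f + sum g            ≡⟨ cong₂ _+_ (sumFin≡sum f) (sumFin≡sum g) ⟨
  sumFin f + sumFin g      ∎
  where open ≡-Reasoning

*-distribˡ-sumFin : ∀ {n} c (f : Fin n → ℕ) → c * sumFin f ≡ sumFin (λ i → c * f i)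
*-distribˡ-sumFin c f = begin
  c * sumFin f          ≡⟨ cong (c *_) (sumFin≡sum f) ⟩
  c * sum f             ≡⟨ *-distribˡ-sum c f ⟩
  sum (λ i → c * f i)   ≡⟨ sumFin≡sum (λ i → c * f i) ⟨
  sumFin (λ i → c * f i) ∎
  where open ≡-Reasoning

*-distribʳ-sumFin : ∀ {n} c (f : Fin n → ℕ) → sumFin f * c ≡ sumFin (λ i → f i * c)
*-distribʳ-sumFin c f = begin
  sumFin f * c          ≡⟨ cong (_* c) (sumFin≡sum f) ⟩
  sum f * c             ≡⟨ *-distribʳ-sum c f ⟩
  sum (λ i → f i * c)   ≡⟨ sumFin≡sum (λ i → f i * c) ⟨
  sumFin (λ i → f i * c) ∎
  where open ≡-Reasoning

sumFin-comm : ∀ {m n} (f : Fin m → Fin n → ℕ) →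
  sumFin (λ i → sumFin (f i)) ≡ sumFin (λ j → sumFin (λ i → f i j))
sumFin-comm f = begin
  sumFin (λ i → sumFin (f i))             ≡⟨ sumFin-cong (λ i → sumFin≡sum (f i)) ⟩
  sumFin (λ i → sum (f i))                ≡⟨ sumFin≡sum (λ i → sum (f i)) ⟩
  sum (λ i → sum (f i))                   ≡⟨ ∑-comm f ⟩
  sum (λ j → sum (λ i → f i j))           ≡⟨ sumFin≡sum (λ j → sum (λ i → f i j)) ⟨
  sumFin (λ j → sum (λ i → f i j))        ≡⟨ sumFin-cong (λ j → sumFin≡sum (λ i → f i j)) ⟨
  sumFin (λ j → sumFin (λ i → f i j))     ∎
  where open ≡-Reasoning

sumFin-zero : ∀ n → sumFin {n} (λ _ → 0) ≡ 0
sumFin-zero zero    = refl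
sumFin-zero (suc n) = sumFin-zero n

sumFin-product : ∀ {n} (x y : Fin n → ℕ) →
  sumFin (λ u → sumFin (λ v → x u * y v)) ≡ sumFin x * sumFin y
sumFin-product x y = begin
  sumFin (λ u → sumFin (λ v → x u * y v)) ≡⟨ sumFin-cong (λ u → *-distribˡ-sumFin (x u) y) ⟨
  sumFin (λ u → x u * sumFin y)           ≡⟨ *-distribʳ-sumFin (sumFin y) x ⟨
  sumFin x * sumFin y                     ∎
  where open ≡-Reasoning

term≤sumFin : ∀ {n} (f : Fin n → ℕ) i → f i ≤ sumFin f
term≤sumFin f zero    = m≤m+n _ _
term≤sumFin f (suc i) = ≤-trans (term≤sumFin (f ∘ suc) i) (m≤n+m _ (f zero))

sumFin-pos⇒term-pos : ∀ {n} (f : Fin n → ℕ) → 0 < sumFin f → Σ (Fin n) λ i → 0 < f i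
sumFin-pos⇒term-pos {suc n} f 0<Σ with f zero in eq
... | suc _ = zero , subst (0 <_) (sym eq) (s≤s z≤n)
... | zero with sumFin-pos⇒term-pos (f ∘ suc) 0<Σ
...   | i , 0<fi = suc i , 0<fi

eqB-refl : ∀ {n} (u : Fin n) → eqB u u ≡ true
eqB-refl u = dec-true (u F.≟ u) refl

sumFin-indicator : ∀ {n} (u : Fin n) (g : Fin n → ℕ) → sumFin (λ v → b2n (eqB v u) * g v) ≡ g u
sumFin-indicator {suc n} zero g =
  trans (cong₂ _+_ (*-identityˡ (g zero)) (sumFin-zero n)) (+-identityʳ (g zero))
sumFin-indicator (suc u) g = sumFin-indicator u (g ∘ suc)

sumFin-point : ∀ {n} (a : Fin n) → sumFin (λ u → b2n (eqB u a)) ≡ 1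
sumFin-point a = trans (sumFin-cong (λ u → sym (*-identityʳ (b2n (eqB u a))))) (sumFin-indicator a (λ _ → 1))

-- Sums over unordered pairs

when : Bool → ℕ → ℕ
when b x = if b then x else 0

sumPairs-cong : ∀ {n} {s t : Fin n → Fin n → ℕ} → (∀ u v → s u v ≡ t u v) → sumPairs s ≡ sumPairs t
sumPairs-cong s≗t = sumFin-cong λ u → sumFin-cong λ v → cong (when _) (s≗t u v)

sumPairs-mono : ∀ {n} {s t : Fin n → Fin n → ℕ} → (∀ u v → s u v ≤ t u v) → sumPairs s ≤ sumPairs t
sumPairs-mono s≤t = sumFin-mono λ u → sumFin-mono λ v → when-mono _ (s≤t u v)
  where
  when-mono : ∀ b {x y} → x ≤ y → when b x ≤ when b y
  when-mono true  x≤y = x≤y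
  when-mono false x≤y = z≤n

sumFin²-distrib-+ : ∀ {m n} (s t : Fin m → Fin n → ℕ) →
  sumFin (λ u → sumFin (λ v → s u v + t u v)) ≡ sumFin (λ u → sumFin (s u)) + sumFin (λ u → sumFin (t u))
sumFin²-distrib-+ s t = trans (sumFin-cong (λ u → sumFin-distrib-+ (s u) (t u)))
                              (sumFin-distrib-+ (λ u → sumFin (s u)) (λ u → sumFin (t u)))

strictUpper : ∀ {n} → (Fin n → Fin n → ℕ) → Fin n → Fin n → ℕ
strictUpper s u v = when (does (toℕ u ℕ.<? toℕ v)) (s u v)

sumPairs-distrib-+ : ∀ {n} (s t : Fin n → Fin n → ℕ) →
  sumPairs (λ u v → s u v + t u v) ≡ sumPairs s + sumPairs t
sumPairs-distrib-+ s t = begin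
  sumPairs (λ u v → s u v + t u v)
    ≡⟨ sumFin-cong (λ u → sumFin-cong (λ v → when-+ _ (s u v) (t u v))) ⟩
  sumFin (λ u → sumFin (λ v → strictUpper s u v + strictUpper t u v))
    ≡⟨ sumFin²-distrib-+ (strictUpper s) (strictUpper t) ⟩
  sumPairs s + sumPairs t ∎
  where
  open ≡-Reasoning
  when-+ : ∀ b x y → when b (x + y) ≡ when b x + when b y
  when-+ true  x y = refl
  when-+ false x y = refl

*-distribˡ-sumPairs : ∀ {n} c (s : Fin n → Fin n → ℕ) → c * sumPairs s ≡ sumPairs (λ u v → c * s u v)
*-distribˡ-sumPairs c s = begin
  c * sumPairs s
    ≡⟨ *-distribˡ-sumFin c (λ u → sumFin (strictUpper s u)) ⟩
  sumFin (λ u → c * sumFin (strictUpper s u))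
    ≡⟨ sumFin-cong (λ u → *-distribˡ-sumFin c (strictUpper s u)) ⟩
  sumFin (λ u → sumFin (λ v → c * strictUpper s u v))
    ≡⟨ sumFin-cong (λ u → sumFin-cong (λ v → *-when _ (s u v))) ⟩
  sumPairs (λ u v → c * s u v) ∎
  where
  open ≡-Reasoning
  *-when : ∀ b x → c * when b x ≡ when b (c * x)
  *-when true  x = refl
  *-when false x = *-zeroʳ c

term≤sumPairs : ∀ {n} (s : Fin n → Fin n → ℕ) {u v} → toℕ u < toℕ v → s u v ≤ sumPairs s
term≤sumPairs s {u} {v} u<v = begin
  s u v                             ≡⟨ cong (λ b → when b (s u v)) (dec-true (toℕ u ℕ.<? toℕ v) u<v) ⟨
  strictUpper s u v                 ≤⟨ term≤sumFin (strictUpper s u) v ⟩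
  sumFin (strictUpper s u)          ≤⟨ term≤sumFin (λ u → sumFin (strictUpper s u)) u ⟩
  sumPairs s ∎
  where open ≤-Reasoning

sumPairs-symmetrize : ∀ {n} (s : Fin n → Fin n → ℕ) →
  sumPairs (λ u v → s u v + s v u) + sumFin (λ u → s u u) ≡ sumFin (λ u → sumFin (s u))
sumPairs-symmetrize s = begin
  sumPairs (λ u v → s u v + s v u) + sumFin (λ u → s u u)
    ≡⟨ cong₂ _+_ (sumPairs-distrib-+ s sᵀ) (sym (sumFin-cong (λ u → sumFin-indicator u (s u)))) ⟩
  sumPairs s + sumPairs sᵀ + sumFin (λ u → sumFin (diagonal u))
    ≡⟨ cong (λ x → sumPairs s + x + sumFin (λ u → sumFin (diagonal u))) (sumFin-comm (strictUpper sᵀ)) ⟩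
  sumPairs s + sumFin (λ u → sumFin (strictLower u)) + sumFin (λ u → sumFin (diagonal u))
    ≡⟨ cong (_+ sumFin (λ u → sumFin (diagonal u))) (sumFin²-distrib-+ (strictUpper s) strictLower) ⟨
  sumFin (λ u → sumFin (λ v → strictUpper s u v + strictLower u v)) + sumFin (λ u → sumFin (diagonal u))
    ≡⟨ sumFin²-distrib-+ (λ u v → strictUpper s u v + strictLower u v) diagonal ⟨
  sumFin (λ u → sumFin (λ v → strictUpper s u v + strictLower u v + diagonal u v))
    ≡⟨ sumFin-cong (λ u → sumFin-cong (λ v → trichotomy u v)) ⟩
  sumFin (λ u → sumFin (s u)) ∎
  where
  open ≡-Reasoning
  sᵀ strictLower diagonal : _ → _ → ℕ
  sᵀ u v = s v u
  strictLower u v = when (does (toℕ v ℕ.<? toℕ u)) (s u v)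
  diagonal u v = b2n (eqB v u) * s u v

  trichotomy : ∀ u v → strictUpper s u v + strictLower u v + diagonal u v ≡ s u v
  trichotomy u v with <-cmp (toℕ u) (toℕ v)
  ... | tri< u<v _ v≮u
    rewrite dec-true (toℕ u ℕ.<? toℕ v) u<v | dec-false (toℕ v ℕ.<? toℕ u) v≮u
          | dec-false (v F.≟ u) (λ v≡u → <-irrefl (cong toℕ (sym v≡u)) u<v)
    = trans (+-identityʳ _) (+-identityʳ _)
  ... | tri≈ _ u≡v _ with refl ← toℕ-injective u≡v
    rewrite dec-false (toℕ u ℕ.<? toℕ u) (<-irrefl refl) | eqB-refl u
    = +-identityʳ (s u u)
  ... | tri> u≮v _ v<u
    rewrite dec-false (toℕ u ℕ.<? toℕ v) u≮v | dec-true (toℕ v ℕ.<? toℕ u) v<u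
          | dec-false (v F.≟ u) (λ v≡u → <-irrefl (cong toℕ v≡u) v<u)
    = +-identityʳ (s u v)


-- Rationals as fractions of naturals

-- x ≐ a / q says that x equals the fraction a/q (so q ≥ 1); it turns comparisons of rationals
-- into cross-multiplied comparisons of naturals.
infix 4 _≐_/_
data _≐_/_ (x : ℚ) : ℕ → ℕ → Set where
  fraction : ∀ {a b} → toℚᵘ x ℚᵘ.≃ mkℚᵘ (ℤ.+ a) b → x ≐ a / suc b

private
  +-* : ∀ m n → ℤ.+ m ℤ.* ℤ.+ n ≡ ℤ.+ (m * n)
  +-* m n = sym (ℤP.pos-* m n)

  mkℚᵘ-≃ : ∀ {a b c d} → a * suc d ≡ c * suc b → mkℚᵘ (ℤ.+ a) b ℚᵘ.≃ mkℚᵘ (ℤ.+ c) d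
  mkℚᵘ-≃ {a} {b} {c} {d} eq = *≡* (trans (+-* a (suc d)) (trans (cong ℤ.+_ eq) (sym (+-* c (suc b)))))

toℚ-≐ : ∀ m → toℚ m ≐ m / 1
toℚ-≐ m = fraction (ℚP.toℚᵘ-fromℚᵘ (mkℚᵘ (ℤ.+ m) 0))

1ℚ-≐ : 1ℚ ≐ 1 / 1
1ℚ-≐ = fraction ℚᵘP.≃-refl

≐-rescale : ∀ {x a q c r} → x ≐ a / q → a * r ≡ c * q → 1 ≤ r → x ≐ c / r
≐-rescale (fraction x≃) eq (s≤s z≤n) = fraction (ℚᵘP.≃-trans x≃ (mkℚᵘ-≃ eq))

≐-* : ∀ {x y a q c r} → x ≐ a / q → y ≐ c / r → x ℚ.* y ≐ a * c / (q * r)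
≐-* {x} {y} {a} {q} {c} {r} (fraction x≃) (fraction y≃) = fraction
  (ℚᵘP.≃-trans (ℚP.toℚᵘ-homo-* x y)
    (ℚᵘP.≃-trans (ℚᵘP.*-cong x≃ y≃) (*≡* (cong (ℤ._* ℤ.+ (q * r)) (+-* a c)))))

≐-+ : ∀ {x y a q c r} → x ≐ a / q → y ≐ c / r → x ℚ.+ y ≐ a * r + c * q / (q * r)
≐-+ {x} {y} {a} {suc b} {c} {suc d} (fraction x≃) (fraction y≃) = fraction
  (ℚᵘP.≃-trans (ℚP.toℚᵘ-homo-+ x y)
    (ℚᵘP.≃-trans (ℚᵘP.+-cong x≃ y≃)
      (*≡* (cong (ℤ._* ℤ.+ (suc b * suc d)) (trans (cong₂ ℤ._+_ (+-* a (suc d)) (+-* c (suc b)))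
                                 (sym (ℤP.pos-+ (a * suc d) (c * suc b))))))))

≐-≤ : ∀ {x y a q c r} → x ≐ a / q → y ≐ c / r → a * r ≤ c * q → x ℚ.≤ y
≐-≤ {a = a} {q} {c} {r} (fraction x≃) (fraction y≃) ar≤cq = ℚP.toℚᵘ-cancel-≤
  (ℚᵘP.≤-respˡ-≃ (ℚᵘP.≃-sym x≃) (ℚᵘP.≤-respʳ-≃ (ℚᵘP.≃-sym y≃)
    (*≤* (subst₂ ℤ._≤_ (sym (+-* a r)) (sym (+-* c q)) (+≤+ ar≤cq)))))

≤-cross-multiply : ∀ {x y a q c r} → x ℚ.≤ y → x ≐ a / q → y ≐ c / r → a * r ≤ c * q
≤-cross-multiply {a = a} {q} {c} {r} x≤y (fraction x≃) (fraction y≃)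
  with ℚᵘP.≤-respˡ-≃ x≃ (ℚᵘP.≤-respʳ-≃ y≃ (ℚP.toℚᵘ-mono-≤ x≤y))
... | *≤* ar≤cq = ℤP.drop‿+≤+ (subst₂ ℤ._≤_ (+-* a r) (+-* c q) ar≤cq)

÷ℚ-unique : ∀ {x y z} → y ≢ 0ℚ → z ℚ.* y ≡ x → x ÷ℚ y ≡ z
÷ℚ-unique {x} {y} {z} y≢0 zy≡x with y ℚP.≟ 0ℚ
... | yes y≡0 = ⊥-elim (y≢0 y≡0)
... | no y≢0′ = begin
    x ℚ.* ℚ.1/ y          ≡⟨ cong (ℚ._* ℚ.1/ y) zy≡x ⟨
    z ℚ.* y ℚ.* ℚ.1/ y    ≡⟨ ℚP.*-assoc z y (ℚ.1/ y) ⟩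
    z ℚ.* (y ℚ.* ℚ.1/ y)  ≡⟨ cong (z ℚ.*_) (ℚP.*-inverseʳ y) ⟩
    z ℚ.* 1ℚ              ≡⟨ ℚP.*-identityʳ z ⟩
    z                     ∎
  where
  open ≡-Reasoning
  instance _ = ℚ.≢-nonZero y≢0′

≐-≢0 : ∀ {y c r} → y ≐ suc c / r → y ≢ 0ℚ
≐-≢0 {c = c} {suc d} (fraction (*≡* eq)) refl with trans (sym (+-* 0 (suc d))) (trans eq (+-* (suc c) 1))
... | ()

≐-÷ : ∀ {x y a q c r} → x ≐ a / q → y ≐ c / r → 1 ≤ c → x ÷ℚ y ≐ a * r / (q * c)
≐-÷ {x} {y} {a} {suc b} {suc c} {suc d} (fraction x≃) y≐ _ =
  subst (_≐ a * suc d / (suc b * suc c)) (sym (÷ℚ-unique (≐-≢0 y≐) zy≡x)) z≐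
  where
  z = fromℚᵘ (mkℚᵘ (ℤ.+ (a * suc d)) (c + b * suc c))
  z≐ : z ≐ a * suc d / (suc b * suc c)
  z≐ = fraction (ℚP.toℚᵘ-fromℚᵘ _)
  zy≡x : z ℚ.* y ≡ x
  zy≡x with ≐-* z≐ y≐
  ... | fraction zy≃ = ℚP.toℚᵘ-injective
    (ℚᵘP.≃-trans zy≃ (ℚᵘP.≃-trans (mkℚᵘ-≃ (cancel a b c d)) (ℚᵘP.≃-sym x≃)))
    where
    cancel : ∀ a b c d → a * suc d * suc c * suc b ≡ a * (suc b * suc c * suc d)
    cancel = solve-∀

toℚ÷toℚ-≐ : ∀ p q → 1 ≤ q → toℚ p ÷ℚ toℚ q ≐ p / q
toℚ÷toℚ-≐ p q 1≤q = ≐-rescale (≐-÷ (toℚ-≐ p) (toℚ-≐ q) 1≤q) (*-assoc p 1 q) 1≤q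

-- Minimisers over a finite function space

Minimum : {A : Set} → (A → ℚ) → (A → Set) → Set
Minimum {A} Φ P = Σ A λ x₀ → P x₀ × (∀ x → P x → Φ x₀ ℚ.≤ Φ x)

MinimumOrEmpty : {A : Set} → (A → ℚ) → (A → Set) → Set
MinimumOrEmpty Φ P = (∀ x → ¬ P x) ⊎ Minimum Φ P

module _ {A : Set} {Φ : A → ℚ} where

  minimumOrEmpty-⊎ : ∀ {P Q : A → Set} → MinimumOrEmpty Φ P → MinimumOrEmpty Φ Q →
    MinimumOrEmpty Φ (λ x → P x ⊎ Q x)
  minimumOrEmpty-⊎ (inj₁ ∅P) (inj₁ ∅Q) = inj₁ λ { x (inj₁ p) → ∅P x p ; x (inj₂ q) → ∅Q x q }
  minimumOrEmpty-⊎ (inj₁ ∅P) (inj₂ (q₀ , Qq₀ , min)) =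
    inj₂ (q₀ , inj₂ Qq₀ , λ { x (inj₁ p) → ⊥-elim (∅P x p) ; x (inj₂ q) → min x q })
  minimumOrEmpty-⊎ (inj₂ (p₀ , Pp₀ , min)) (inj₁ ∅Q) =
    inj₂ (p₀ , inj₁ Pp₀ , λ { x (inj₁ p) → min x p ; x (inj₂ q) → ⊥-elim (∅Q x q) })
  minimumOrEmpty-⊎ (inj₂ (p₀ , Pp₀ , minP)) (inj₂ (q₀ , Qq₀ , minQ)) with ℚP.≤-total (Φ p₀) (Φ q₀)
  ... | inj₁ p₀≤q₀ = inj₂ (p₀ , inj₁ Pp₀ ,
    λ { x (inj₁ p) → minP x p ; x (inj₂ q) → ℚP.≤-trans p₀≤q₀ (minQ x q) })
  ... | inj₂ q₀≤p₀ = inj₂ (q₀ , inj₂ Qq₀ ,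
    λ { x (inj₁ p) → ℚP.≤-trans q₀≤p₀ (minP x p) ; x (inj₂ q) → minQ x q })

  minimumOrEmpty-⇔ : ∀ {P Q : A → Set} → (∀ x → P x → Q x) → (∀ x → Q x → P x) →
    MinimumOrEmpty Φ P → MinimumOrEmpty Φ Q
  minimumOrEmpty-⇔ P⇒Q Q⇒P (inj₁ ∅P)              = inj₁ λ x q → ∅P x (Q⇒P x q)
  minimumOrEmpty-⇔ P⇒Q Q⇒P (inj₂ (x₀ , Px₀ , min)) = inj₂ (x₀ , P⇒Q x₀ Px₀ , λ x q → min x (Q⇒P x q))

  minimumOrEmpty-∃Fin : ∀ m (P : Fin m → A → Set) → (∀ i → MinimumOrEmpty Φ (P i)) →
    MinimumOrEmpty Φ (λ x → ∃ λ i → P i x)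
  minimumOrEmpty-∃Fin zero    P minₚ = inj₁ λ { x (() , _) }
  minimumOrEmpty-∃Fin (suc m) P minₚ = minimumOrEmpty-⇔
    (λ { x (inj₁ p) → zero , p ; x (inj₂ (i , p)) → suc i , p })
    (λ { x (zero , p) → inj₁ p ; x (suc i , p) → inj₂ (i , p) })
    (minimumOrEmpty-⊎ (minₚ zero) (minimumOrEmpty-∃Fin m (λ i → P (suc i)) (λ i → minₚ (suc i))))

minimumOrEmpty-functions : ∀ n {k} (Φ : (Fin n → Fin k) → ℚ) (P : (Fin n → Fin k) → Set) →
  (∀ f → Dec (P f)) → (∀ {f g} → f ≗ g → Φ f ≡ Φ g) → (∀ {f g} → f ≗ g → P f → P g) →
  MinimumOrEmpty Φ P
minimumOrEmpty-functions zero Φ P P? Φ-resp P-resp with P? (λ ())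
... | yes P[] = inj₂ ((λ ()) , P[] , λ f _ → ℚP.≤-reflexive (Φ-resp (λ ())))
... | no ¬P[] = inj₁ λ f Pf → ¬P[] (P-resp (λ ()) Pf)
minimumOrEmpty-functions (suc n) {k} Φ P P? Φ-resp P-resp =
  minimumOrEmpty-⇔ (λ f (_ , Pf , _) → Pf) (λ f Pf → head f , Pf , refl)
    (minimumOrEmpty-∃Fin k (λ i f → P f × head f ≡ i) withHead)
  where
  η : ∀ f → f ≗ head f ∷ tail f
  η f zero    = refl
  η f (suc j) = refl

  ∷-cong : ∀ i {g g′ : Fin n → Fin k} → g ≗ g′ → i ∷ g ≗ i ∷ g′
  ∷-cong i g≗g′ zero    = refl
  ∷-cong i g≗g′ (suc j) = g≗g′ j

  withHead : ∀ i → MinimumOrEmpty Φ (λ f → P f × head f ≡ i)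
  withHead i with minimumOrEmpty-functions n (λ g → Φ (i ∷ g)) (λ g → P (i ∷ g)) (λ g → P? (i ∷ g))
                    (λ g≗g′ → Φ-resp (∷-cong i g≗g′)) (λ g≗g′ → P-resp (∷-cong i g≗g′))
  ... | inj₁ ∅ = inj₁ λ { f (Pf , refl) → ∅ (tail f) (P-resp (η f) Pf) }
  ... | inj₂ (g₀ , Pg₀ , min) = inj₂ (i ∷ g₀ , (Pg₀ , refl) ,
        λ { f (Pf , refl) → ℚP.≤-trans (min (tail f) (P-resp (η f) Pf)) (ℚP.≤-reflexive (sym (Φ-resp (η f)))) })

-- Distances, degrees and the quotient R_f

b2n≤1 : ∀ b → b2n b ≤ 1
b2n≤1 true  = ≤-refl
b2n≤1 false = z≤n

b2n-∧ : ∀ x y → b2n (x ∧ y) ≡ b2n x * b2n y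
b2n-∧ true  y = sym (+-identityʳ (b2n y))
b2n-∧ false y = refl

b2n-∨-disjoint : ∀ x y → (y ≡ true → x ≡ false) → b2n (x ∨ y) ≡ b2n x + b2n y
b2n-∨-disjoint true  true  disj with disj refl
... | ()
b2n-∨-disjoint true  false disj = refl
b2n-∨-disjoint false y     disj = refl

b2n+b2n-not : ∀ b → b2n b + b2n (not b) ≡ 1
b2n+b2n-not true  = refl
b2n+b2n-not false = refl

sq-mono : ∀ {x y} → x ≤ y → sq x ≤ sq y
sq-mono x≤y = *-mono-≤ x≤y x≤y

m+n∸1≤m*n : ∀ {m n} → 1 ≤ m → 1 ≤ n → m + n ∸ 1 ≤ m * n
m+n∸1≤m*n {suc m} {suc n} _ _ = begin
  m + suc n       ≡⟨ +-comm m (suc n) ⟩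
  suc n + m       ≤⟨ +-monoʳ-≤ (suc n) (m≤m*n m (suc n)) ⟩
  suc n + m * suc n ∎
  where open ≤-Reasoning

searchDist≥start : ∀ {k} (H : Graph k) u v s fuel → s ≤ searchDist H u v s fuel
searchDist≥start H u v s zero = ≤-refl
searchDist≥start H u v s (suc fuel) with within H s u v
... | true  = ≤-refl
... | false = ≤-trans (n≤1+n s) (searchDist≥start H u v (suc s) fuel)

dist-refl : ∀ {k} (H : Graph k) x → dist H x x ≡ 0
dist-refl {suc k} H x rewrite eqB-refl x = refl

dist-pos : ∀ {k} (H : Graph k) {x y} → x ≢ y → 1 ≤ dist H x y
dist-pos {suc k} H {x} {y} x≢y rewrite dec-false (x F.≟ y) x≢y = searchDist≥start H x y 1 k

maxFin-upper : ∀ {n} (f : Fin n → ℕ) i → f i ≤ maxFin f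
maxFin-upper f zero    = m≤m⊔n _ _
maxFin-upper f (suc i) = ≤-trans (maxFin-upper (f ∘ suc) i) (m≤n⊔m (f zero) _)

dist≤diameter : ∀ {k} (H : Graph k) x y → dist H x y ≤ diameter H
dist≤diameter H x y =
  ≤-trans (maxFin-upper (dist H x) y) (maxFin-upper (λ u → maxFin (dist H u)) x)

distSq : ∀ {n k} → Graph k → (Fin n → Fin k) → Fin n → Fin n → ℕ
distSq H f x y = sq (dist H (f x) (f y))

distSq≥1 : ∀ {n k} (H : Graph k) (f : Fin n → Fin k) {x y} → f x ≢ f y → 1 ≤ distSq H f x y
distSq≥1 H f fx≢fy = sq-mono (dist-pos H fx≢fy)

distSq≤sq-diameter : ∀ {n k} (H : Graph k) (f : Fin n → Fin k) x y → distSq H f x y ≤ sq (diameter H)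
distSq≤sq-diameter H f x y = sq-mono (dist≤diameter H (f x) (f y))

edge-of-walk : ∀ {n} {G : Graph n} {u v l} → Walk G u v l → u ≢ v → ∃ λ w → adj G u w ≡ true
edge-of-walk here       u≢u = ⊥-elim (u≢u refl)
edge-of-walk (step e _) _   = _ , e

another-vertex : ∀ {n} (u : Fin (suc (suc n))) → Σ (Fin (suc (suc n))) (u ≢_)
another-vertex zero    = suc zero , λ ()
another-vertex (suc _) = zero , λ ()

connected⇒deg≥1 : ∀ {n} (G : Graph (suc (suc n))) → Connected G → ∀ u → 1 ≤ deg G u
connected⇒deg≥1 G conn u =
  let v , u≢v = another-vertex u
      w , uw∈G = edge-of-walk (proj₂ (conn u v)) u≢v
  in ≤-trans (≤-reflexive (cong b2n (sym uw∈G))) (term≤sumFin (b2n ∘ adj G u) w)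

cut-edge-of-walk : ∀ {n m} {G : Graph n} (f : Fin n → Fin m) {u v l} → Walk G u v l → f u ≢ f v →
  Σ (Fin n) λ x → Σ (Fin n) λ y → adj G x y ≡ true × f x ≢ f y
cut-edge-of-walk f here fu≢fu = ⊥-elim (fu≢fu refl)
cut-edge-of-walk f (step {u} {w} uw∈G walk) fu≢fv with f u F.≟ f w
... | yes fu≡fw = cut-edge-of-walk f walk (λ fw≡fv → fu≢fv (trans fu≡fw fw≡fv))
... | no fu≢fw  = u , w , uw∈G , fu≢fw

edge⇒≢ : ∀ {n} (G : Graph n) {x y} → adj G x y ≡ true → x ≢ y
edge⇒≢ G {x} xy∈G refl with trans (sym xy∈G) (irrefl G x)
... | ()

edge-term≥1 : ∀ {n k} (G : Graph n) (H : Graph k) (f : Fin n → Fin k) {x y} →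
  adj G x y ≡ true → f x ≢ f y → 1 ≤ b2n (adj G x y) * distSq H f x y
edge-term≥1 G H f xy∈G fx≢fy rewrite xy∈G = ≤-trans (distSq≥1 H f fx≢fy) (m≤m+n _ 0)

cut-edge⇒numer≥1 : ∀ {n k} (G : Graph n) (H : Graph k) (f : Fin n → Fin k) {x y} →
  adj G x y ≡ true → f x ≢ f y → 1 ≤ numer G H f
cut-edge⇒numer≥1 G H f {x} {y} xy∈G fx≢fy with <-cmp (toℕ x) (toℕ y)
... | tri< x<y _ _ = ≤-trans (edge-term≥1 G H f xy∈G fx≢fy) (term≤sumPairs _ x<y)
... | tri≈ _ x≡y _ = ⊥-elim (edge⇒≢ G xy∈G (toℕ-injective x≡y))
... | tri> _ _ y<x =
  ≤-trans (edge-term≥1 G H f (trans (Graph.sym G y x) xy∈G) (fx≢fy ∘ sym)) (term≤sumPairs _ y<x)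

nonconstant⇒numer≥1 : ∀ {n k} (G : Graph n) (H : Graph k) (f : Fin n → Fin k) → Connected G →
  ∀ {u v} → f u ≢ f v → 1 ≤ numer G H f
nonconstant⇒numer≥1 G H f conn {u} {v} fu≢fv with cut-edge-of-walk f (proj₂ (conn u v)) fu≢fv
... | _ , _ , xy∈G , fx≢fy = cut-edge⇒numer≥1 G H f xy∈G fx≢fy

crossing-pair≤ : ∀ a b D w → (a ≢ b → 1 ≤ w) → b2n (a ∧ not b) * D + b2n (b ∧ not a) * D ≤ w * D
crossing-pair≤ true  true  D w _   = z≤n
crossing-pair≤ true  false D w w≥1 = ≤-trans (≤-reflexive (+-identityʳ (1 * D))) (*-monoˡ-≤ D (w≥1 λ ()))
crossing-pair≤ false true  D w w≥1 = *-monoˡ-≤ D (w≥1 λ ())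
crossing-pair≤ false false D w _   = z≤n

cut-volumes≤ : ∀ {n} (c : Fin n → Bool) (d : Fin n → ℕ) (w : Fin n → Fin n → ℕ) →
  (∀ x y → c x ≢ c y → 1 ≤ w x y) →
  sumFin (λ x → b2n (c x) * d x) * sumFin (λ x → b2n (not (c x)) * d x)
    ≤ sumPairs (λ x y → w x y * (d x * d y))
cut-volumes≤ {n} c d w crossing⇒w≥1 = begin
  sumFin (λ x → b2n (c x) * d x) * sumFin (λ y → b2n (not (c y)) * d y)
    ≡⟨ sumFin-product (λ x → b2n (c x) * d x) (λ y → b2n (not (c y)) * d y) ⟨
  sumFin (λ x → sumFin (λ y → (b2n (c x) * d x) * (b2n (not (c y)) * d y)))
    ≡⟨ sumFin-cong (λ x → sumFin-cong (λ y → regroup x y)) ⟩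
  sumFin (λ x → sumFin (s x))
    ≡⟨ sumPairs-symmetrize s ⟨
  sumPairs (λ x y → s x y + s y x) + sumFin (λ x → s x x)
    ≡⟨ cong (sumPairs (λ x y → s x y + s y x) +_) (trans (sumFin-cong no-loop) (sumFin-zero n)) ⟩
  sumPairs (λ x y → s x y + s y x) + 0
    ≡⟨ +-identityʳ _ ⟩
  sumPairs (λ x y → s x y + s y x)
    ≤⟨ sumPairs-mono (λ x y → subst (λ D → s x y + b2n (c y ∧ not (c x)) * D ≤ w x y * (d x * d y))
                               (*-comm (d x) (d y))
                               (crossing-pair≤ (c x) (c y) (d x * d y) (w x y) (crossing⇒w≥1 x y))) ⟩
  sumPairs (λ x y → w x y * (d x * d y)) ∎
  where
  open ≤-Reasoning
  s : _ → _ → ℕ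
  s x y = b2n (c x ∧ not (c y)) * (d x * d y)
  regroup : ∀ x y → (b2n (c x) * d x) * (b2n (not (c y)) * d y) ≡ s x y
  regroup x y = trans (*-interchange (b2n (c x)) (d x) (b2n (not (c y))) (d y))
                      (cong (_* (d x * d y)) (sym (b2n-∧ (c x) (not (c y)))))
  no-loop : ∀ x → s x x ≡ 0
  no-loop x with c x
  ... | true  = refl
  ... | false = refl

nonconstant⇒vol∸1≤denom : ∀ {n k} (G : Graph n) (H : Graph k) (f : Fin n → Fin k) →
  (∀ u → 1 ≤ deg G u) → ∀ {u v} → f u ≢ f v → vol G ∸ 1 ≤ denom G H f
nonconstant⇒vol∸1≤denom G H f deg≥1 {u} {v} fu≢fv = begin
  vol G ∸ 1          ≡⟨ cong (_∸ 1) split ⟨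
  A + B ∸ 1          ≤⟨ m+n∸1≤m*n A≥1 B≥1 ⟩
  A * B              ≤⟨ cut-volumes≤ c (deg G) (distSq H f) (λ x y cx≢cy → distSq≥1 H f (cx≢cy ∘ cong c′)) ⟩
  denom G H f        ∎
  where
  open ≤-Reasoning
  c′ : _ → Bool
  c′ y = eqB y (f u)
  c : _ → Bool
  c = c′ ∘ f
  A B : ℕ
  A = sumFin (λ x → b2n (c x) * deg G x)
  B = sumFin (λ x → b2n (not (c x)) * deg G x)
  split : A + B ≡ vol G
  split = trans (sym (sumFin-distrib-+ (λ x → b2n (c x) * deg G x) (λ x → b2n (not (c x)) * deg G x)))
                (sumFin-cong λ x → trans (sym (*-distribʳ-+ (deg G x) (b2n (c x)) (b2n (not (c x)))))
                                         (trans (cong (_* deg G x) (b2n+b2n-not (c x))) (*-identityˡ (deg G x))))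
  A≥1 : 1 ≤ A
  A≥1 = ≤-trans (subst (λ b → 1 ≤ b2n b * deg G u) (sym (eqB-refl (f u))) (≤-trans (deg≥1 u) (m≤m+n _ 0)))
                (term≤sumFin (λ x → b2n (c x) * deg G x) u)
  B≥1 : 1 ≤ B
  B≥1 = ≤-trans (subst (λ b → 1 ≤ b2n (not b) * deg G v) (sym (dec-false (f v F.≟ f u) (fu≢fv ∘ sym)))
                       (≤-trans (deg≥1 v) (m≤m+n _ 0)))
                (term≤sumFin (λ x → b2n (not (c x)) * deg G x) v)

denom≢0⇒nonconstant : ∀ {n k} (G : Graph n) (H : Graph k) (f : Fin n → Fin k) →
  denom G H f ≢ 0 → Σ (Fin n) λ u → Σ (Fin n) λ v → f u ≢ f v
denom≢0⇒nonconstant G H f denom≢0 with sumFin-pos⇒term-pos _ (n≢0⇒n>0 denom≢0)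
... | u , row>0 with sumFin-pos⇒term-pos _ row>0
...   | v , term>0 = u , v , λ fu≡fv → <-irrefl (sym (strictUpper-zero (does (toℕ u ℕ.<? toℕ v)) fu≡fv)) term>0
  where
  strictUpper-zero : ∀ b → f u ≡ f v → when b (distSq H f u v * (deg G u * deg G v)) ≡ 0
  strictUpper-zero false _ = refl
  strictUpper-zero true fu≡fv rewrite fu≡fv | dist-refl H (f v) = refl

-- λ(G,H) is attained

module _ {n k} (G : Graph n) (H : Graph k) where

  Admissible : (Fin n → Fin k) → Set
  Admissible f = denom G H f ≢ 0

  IsMinimizer : (Fin n → Fin k) → Set
  IsMinimizer f₀ = Admissible f₀ × (∀ f → Admissible f → R G H f₀ ℚ.≤ R G H f)

  numer-cong : ∀ {f g} → f ≗ g → numer G H f ≡ numer G H g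
  numer-cong f≗g = sumPairs-cong λ u v → cong (λ d → b2n (adj G u v) * sq d) (cong₂ (dist H) (f≗g u) (f≗g v))

  denom-cong : ∀ {f g} → f ≗ g → denom G H f ≡ denom G H g
  denom-cong f≗g = sumPairs-cong λ u v → cong (λ d → sq d * (deg G u * deg G v)) (cong₂ (dist H) (f≗g u) (f≗g v))

  R-≐ : ∀ f → Admissible f → R G H f ≐ vol G * numer G H f / denom G H f
  R-≐ f adm = toℚ÷toℚ-≐ (vol G * numer G H f) (denom G H f) (n≢0⇒n>0 adm)

  R-≤⇒cross : ∀ {f g} → 1 ≤ vol G → Admissible f → Admissible g → R G H f ℚ.≤ R G H g →
    numer G H f * denom G H g ≤ numer G H g * denom G H f
  R-≤⇒cross {f} {g} 1≤V adm-f adm-g Rf≤Rg = *-cancelˡ-≤ (vol G) {{ℕ.>-nonZero 1≤V}} (begin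
    vol G * (numer G H f * denom G H g)   ≡⟨ *-assoc (vol G) _ _ ⟨
    vol G * numer G H f * denom G H g     ≤⟨ ≤-cross-multiply Rf≤Rg (R-≐ f adm-f) (R-≐ g adm-g) ⟩
    vol G * numer G H g * denom G H f     ≡⟨ *-assoc (vol G) _ _ ⟩
    vol G * (numer G H g * denom G H f)   ∎)
    where open ≤-Reasoning

  -- Opaque: at a concrete number of vertices Agda would otherwise run the exhaustive search.
  opaque
    minimizer-exists : ∀ f₁ → Admissible f₁ → Σ (Fin n → Fin k) IsMinimizer
    minimizer-exists f₁ adm₁
      with minimumOrEmpty-functions n (R G H) Admissible (λ f → ¬? (denom G H f ℕ.≟ 0))
             (λ f≗g → cong₂ (λ N D → toℚ (vol G * N) ÷ℚ toℚ D) (numer-cong f≗g) (denom-cong f≗g))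
             (λ f≗g adm-f → adm-f ∘ trans (denom-cong f≗g))
    ... | inj₁ none = ⊥-elim (none f₁ adm₁)
    ... | inj₂ min  = min

  minimizer⇒IsLambda : ∀ {f₀} → IsMinimizer f₀ → IsLambda G H (R G H f₀)
  minimizer⇒IsLambda (adm₀ , min₀) = min₀ , λ m m-lower → m-lower _ adm₀

  lambda-exists : ∀ f₁ → Admissible f₁ → Σ ℚ (IsLambda G H)
  lambda-exists f₁ adm₁ = let f₀ , f₀-min = minimizer-exists f₁ adm₁ in R G H f₀ , minimizer⇒IsLambda f₀-min

  IsLambda-unique : ∀ {ℓ m} → IsLambda G H ℓ → IsLambda G H m → ℓ ≡ m
  IsLambda-unique (ℓ-lower , ℓ-greatest) (m-lower , m-greatest) =
    ℚP.≤-antisym (m-greatest _ ℓ-lower) (ℓ-greatest _ m-lower)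

-- Adding the edge {a,b}

module AddEdge {n} (G G′ : Graph n) (a b : Fin n) (a≢b : a ≢ b) (ab∉G : adj G a b ≡ false)
  (G′≡G+ab : ∀ u v → adj G′ u v ≡ addEdgeAdj G a b u v) where

  isA isB ends : Fin n → ℕ
  isA u = b2n (eqB u a)
  isB u = b2n (eqB u b)
  ends u = isA u + isB u

  newEdge : Fin n → Fin n → ℕ
  newEdge u v = isA u * isB v + isA v * isB u

  new⇒∉G : ∀ u v → ((eqB u a ∧ eqB v b) ∨ (eqB u b ∧ eqB v a)) ≡ true → adj G u v ≡ false
  new⇒∉G u v new with u F.≟ a | v F.≟ b | u F.≟ b | v F.≟ a
  ... | yes refl | yes refl | _        | _        = ab∉G
  ... | _        | _        | yes refl | yes refl = trans (Graph.sym G b a) ab∉G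
  new⇒∉G u v () | no _  | _    | no _  | _
  new⇒∉G u v () | no _  | _    | yes _ | no _
  new⇒∉G u v () | yes _ | no _ | no _  | _
  new⇒∉G u v () | yes _ | no _ | yes _ | no _

  ba⇒¬ab : ∀ u v → (eqB u b ∧ eqB v a) ≡ true → (eqB u a ∧ eqB v b) ≡ false
  ba⇒¬ab u v ba with u F.≟ b | u F.≟ a
  ... | yes refl | yes b≡a = ⊥-elim (a≢b (sym b≡a))
  ... | yes refl | no _    = refl
  ba⇒¬ab u v () | no _ | _

  adj′-split : ∀ u v → b2n (adj G′ u v) ≡ b2n (adj G u v) + newEdge u v
  adj′-split u v = begin
    b2n (adj G′ u v)
      ≡⟨ cong b2n (G′≡G+ab u v) ⟩
    b2n (adj G u v ∨ ((eqB u a ∧ eqB v b) ∨ (eqB u b ∧ eqB v a)))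
      ≡⟨ b2n-∨-disjoint (adj G u v) _ (new⇒∉G u v) ⟩
    b2n (adj G u v) + b2n ((eqB u a ∧ eqB v b) ∨ (eqB u b ∧ eqB v a))
      ≡⟨ cong (b2n (adj G u v) +_) (b2n-∨-disjoint (eqB u a ∧ eqB v b) (eqB u b ∧ eqB v a) (ba⇒¬ab u v)) ⟩
    b2n (adj G u v) + (b2n (eqB u a ∧ eqB v b) + b2n (eqB u b ∧ eqB v a))
      ≡⟨ cong (b2n (adj G u v) +_) (cong₂ _+_ (b2n-∧ (eqB u a) (eqB v b))
                                              (trans (b2n-∧ (eqB u b) (eqB v a)) (*-comm (isB u) (isA v)))) ⟩
    b2n (adj G u v) + newEdge u v ∎
    where open ≡-Reasoning

  deg′ : ∀ u → deg G′ u ≡ deg G u + ends u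
  deg′ u = begin
    sumFin (λ v → b2n (adj G′ u v))
      ≡⟨ sumFin-cong (adj′-split u) ⟩
    sumFin (λ v → b2n (adj G u v) + (isA u * isB v + isA v * isB u))
      ≡⟨ sumFin-distrib-+ (λ v → b2n (adj G u v)) (λ v → isA u * isB v + isA v * isB u) ⟩
    deg G u + sumFin (λ v → isA u * isB v + isA v * isB u)
      ≡⟨ cong (deg G u +_) (sumFin-distrib-+ (λ v → isA u * isB v) (λ v → isA v * isB u)) ⟩
    deg G u + (sumFin (λ v → isA u * isB v) + sumFin (λ v → isA v * isB u))
      ≡⟨ cong (deg G u +_) (cong₂ _+_ (*-distribˡ-sumFin (isA u) isB) (*-distribʳ-sumFin (isB u) isA)) ⟨
    deg G u + (isA u * sumFin isB + sumFin isA * isB u)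
      ≡⟨ cong (deg G u +_) (cong₂ _+_ (cong (isA u *_) (sumFin-point b)) (cong (_* isB u) (sumFin-point a))) ⟩
    deg G u + (isA u * 1 + 1 * isB u)
      ≡⟨ cong (deg G u +_) (cong₂ _+_ (*-identityʳ (isA u)) (*-identityˡ (isB u))) ⟩
    deg G u + ends u ∎
    where open ≡-Reasoning

  sumFin-ends : sumFin ends ≡ 2
  sumFin-ends = trans (sumFin-distrib-+ isA isB) (cong₂ _+_ (sumFin-point a) (sumFin-point b))

  vol′ : vol G′ ≡ vol G + 2
  vol′ = begin
    sumFin (deg G′)                  ≡⟨ sumFin-cong deg′ ⟩
    sumFin (λ u → deg G u + ends u)  ≡⟨ sumFin-distrib-+ (deg G) ends ⟩
    vol G + sumFin ends              ≡⟨ cong (vol G +_) sumFin-ends ⟩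
    vol G + 2                        ∎
    where open ≡-Reasoning

  ends≤1 : ∀ u → ends u ≤ 1
  ends≤1 u with u F.≟ a
  ... | no _    = b2n≤1 (eqB u b)
  ... | yes refl with a F.≟ b
  ...   | yes a≡b = ⊥-elim (a≢b a≡b)
  ...   | no _    = ≤-refl

  deg≤deg′ : ∀ u → deg G u ≤ deg G′ u
  deg≤deg′ u = subst (deg G u ≤_) (sym (deg′ u)) (m≤m+n (deg G u) (ends u))

  deg′≤2*deg : (∀ u → 1 ≤ deg G u) → ∀ u → deg G′ u ≤ 2 * deg G u
  deg′≤2*deg deg≥1 u = begin
    deg G′ u               ≡⟨ deg′ u ⟩
    deg G u + ends u       ≤⟨ +-monoʳ-≤ (deg G u) (≤-trans (ends≤1 u) (deg≥1 u)) ⟩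
    deg G u + deg G u      ≡⟨ cong (deg G u +_) (+-identityʳ (deg G u)) ⟨
    2 * deg G u            ∎
    where open ≤-Reasoning

  sumPairs-newEdge≤1 : sumPairs newEdge ≤ 1
  sumPairs-newEdge≤1 = begin
    sumPairs newEdge                           ≤⟨ m≤m+n _ _ ⟩
    sumPairs newEdge + sumFin (λ u → q u u)    ≡⟨ sumPairs-symmetrize q ⟩
    sumFin (λ u → sumFin (q u))                ≡⟨ sumFin-product isA isB ⟩
    sumFin isA * sumFin isB                    ≡⟨ cong₂ _*_ (sumFin-point a) (sumFin-point b) ⟩
    1                                          ∎
    where
    open ≤-Reasoning
    q : Fin n → Fin n → ℕ
    q u v = isA u * isB v

  sumPairs-deg*ends≤2*vol : sumPairs (λ u v → deg G u * ends v + deg G v * ends u) ≤ vol G * 2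
  sumPairs-deg*ends≤2*vol = begin
    sumPairs (λ u v → s u v + s v u)              ≤⟨ m≤m+n _ _ ⟩
    sumPairs (λ u v → s u v + s v u) + sumFin (λ u → s u u) ≡⟨ sumPairs-symmetrize s ⟩
    sumFin (λ u → sumFin (s u))                   ≡⟨ sumFin-product (deg G) ends ⟩
    vol G * sumFin ends                           ≡⟨ cong (vol G *_) sumFin-ends ⟩
    vol G * 2                                     ∎
    where
    open ≤-Reasoning
    s : Fin n → Fin n → ℕ
    s u v = deg G u * ends v

  sumPairs-ends*ends≤1 : sumPairs (λ u v → ends u * ends v) ≤ 1
  sumPairs-ends*ends≤1 = *-cancelˡ-≤ 2 (begin
    2 * sumPairs t
      ≡⟨ *-distribˡ-sumPairs 2 t ⟩
    sumPairs (λ u v → 2 * t u v)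
      ≡⟨ sumPairs-cong (λ u v → cong (t u v +_) (trans (+-identityʳ (t u v)) (*-comm (ends u) (ends v)))) ⟩
    sumPairs (λ u v → t u v + t v u)
      ≡⟨ +-cancelʳ-≡ _ _ _ symmetrized ⟩
    2 ∎)
    where
    open ≤-Reasoning
    t : Fin n → Fin n → ℕ
    t u v = ends u * ends v
    symmetrized : sumPairs (λ u v → t u v + t v u) + sumFin (λ u → t u u) ≡ 2 + sumFin (λ u → t u u)
    symmetrized = begin-equality
      sumPairs (λ u v → t u v + t v u) + sumFin (λ u → t u u) ≡⟨ sumPairs-symmetrize t ⟩
      sumFin (λ u → sumFin (t u))                           ≡⟨ sumFin-product ends ends ⟩
      sumFin ends * sumFin ends                             ≡⟨ cong₂ _*_ sumFin-ends sumFin-ends ⟩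
      2 + 2                                                 ≡⟨ cong (2 +_) (sym sumFin-ends) ⟩
      2 + sumFin ends                                       ≡⟨ cong (2 +_) (sumFin-cong λ u → sym (m≤1⇒m*m≡m (ends≤1 u))) ⟩
      2 + sumFin (λ u → t u u)                              ∎
      where
      m≤1⇒m*m≡m : ∀ {m} → m ≤ 1 → m * m ≡ m
      m≤1⇒m*m≡m z≤n       = refl
      m≤1⇒m*m≡m (s≤s z≤n) = refl

  module _ {k} (H : Graph k) (f : Fin n → Fin k) where

    private
      w : Fin n → Fin n → ℕ
      w = distSq H f
      Δ : ℕ
      Δ = sq (diameter H)

    numer≤numer′ : numer G H f ≤ numer G′ H f
    numer≤numer′ = sumPairs-mono λ u v →
      *-monoˡ-≤ (w u v) (subst (b2n (adj G u v) ≤_) (sym (adj′-split u v)) (m≤m+n _ _))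

    numer′≤numer+Δ : numer G′ H f ≤ numer G H f + Δ
    numer′≤numer+Δ = begin
      numer G′ H f
        ≤⟨ sumPairs-mono pairwise ⟩
      sumPairs (λ u v → b2n (adj G u v) * w u v + Δ * newEdge u v)
        ≡⟨ sumPairs-distrib-+ (λ u v → b2n (adj G u v) * w u v) (λ u v → Δ * newEdge u v) ⟩
      numer G H f + sumPairs (λ u v → Δ * newEdge u v)
        ≡⟨ cong (numer G H f +_) (*-distribˡ-sumPairs Δ newEdge) ⟨
      numer G H f + Δ * sumPairs newEdge
        ≤⟨ +-monoʳ-≤ (numer G H f) (*-monoʳ-≤ Δ sumPairs-newEdge≤1) ⟩
      numer G H f + Δ * 1
        ≡⟨ cong (numer G H f +_) (*-identityʳ Δ) ⟩
      numer G H f + Δ ∎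
      where
      open ≤-Reasoning
      pairwise : ∀ u v → b2n (adj G′ u v) * w u v ≤ b2n (adj G u v) * w u v + Δ * newEdge u v
      pairwise u v = begin
        b2n (adj G′ u v) * w u v                             ≡⟨ cong (_* w u v) (adj′-split u v) ⟩
        (b2n (adj G u v) + newEdge u v) * w u v
          ≡⟨ *-distribʳ-+ (w u v) (b2n (adj G u v)) (newEdge u v) ⟩
        b2n (adj G u v) * w u v + newEdge u v * w u v
          ≤⟨ +-monoʳ-≤ _ (*-monoʳ-≤ (newEdge u v) (distSq≤sq-diameter H f u v)) ⟩
        b2n (adj G u v) * w u v + newEdge u v * Δ
          ≡⟨ cong (b2n (adj G u v) * w u v +_) (*-comm (newEdge u v) Δ) ⟩
        b2n (adj G u v) * w u v + Δ * newEdge u v            ∎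

    denom≤denom′ : denom G H f ≤ denom G′ H f
    denom≤denom′ = sumPairs-mono λ u v → *-monoʳ-≤ (w u v) (*-mono-≤ (deg≤deg′ u) (deg≤deg′ v))

    admissible⇒admissible′ : Admissible G H f → Admissible G′ H f
    admissible⇒admissible′ adm D′≡0 = adm (n≤0⇒n≡0 (subst (denom G H f ≤_) D′≡0 denom≤denom′))

    denom′≤4*denom : (∀ u → 1 ≤ deg G u) → denom G′ H f ≤ 4 * denom G H f
    denom′≤4*denom deg≥1 = begin
      denom G′ H f
        ≤⟨ sumPairs-mono (λ u v → *-monoʳ-≤ (w u v) (*-mono-≤ (deg′≤2*deg deg≥1 u) (deg′≤2*deg deg≥1 v))) ⟩
      sumPairs (λ u v → w u v * (2 * deg G u * (2 * deg G v)))
        ≡⟨ sumPairs-cong (λ u v → regroup (w u v) (deg G u) (deg G v)) ⟩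
      sumPairs (λ u v → 4 * (w u v * (deg G u * deg G v)))
        ≡⟨ *-distribˡ-sumPairs 4 (λ u v → w u v * (deg G u * deg G v)) ⟨
      4 * denom G H f ∎
      where
      open ≤-Reasoning
      regroup : ∀ x y z → x * (2 * y * (2 * z)) ≡ 4 * (x * (y * z))
      regroup = solve-∀

    denom′≤denom+Δ*[2vol+1] : denom G′ H f ≤ denom G H f + Δ * (2 * vol G + 1)
    denom′≤denom+Δ*[2vol+1] = begin
      denom G′ H f
        ≤⟨ sumPairs-mono pairwise ⟩
      sumPairs (λ u v → w u v * (deg G u * deg G v) + Δ * (mixed u v + both u v))
        ≡⟨ sumPairs-distrib-+ (λ u v → w u v * (deg G u * deg G v)) (λ u v → Δ * (mixed u v + both u v)) ⟩
      denom G H f + sumPairs (λ u v → Δ * (mixed u v + both u v))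
        ≡⟨ cong (denom G H f +_) (trans (cong (Δ *_) (sym (sumPairs-distrib-+ mixed both)))
                                         (*-distribˡ-sumPairs Δ (λ u v → mixed u v + both u v))) ⟨
      denom G H f + Δ * (sumPairs mixed + sumPairs both)
        ≤⟨ +-monoʳ-≤ (denom G H f) (*-monoʳ-≤ Δ (+-mono-≤ sumPairs-deg*ends≤2*vol sumPairs-ends*ends≤1)) ⟩
      denom G H f + Δ * (vol G * 2 + 1)
        ≡⟨ cong (λ x → denom G H f + Δ * (x + 1)) (*-comm (vol G) 2) ⟩
      denom G H f + Δ * (2 * vol G + 1) ∎
      where
      open ≤-Reasoning
      mixed both : Fin n → Fin n → ℕ
      mixed u v = deg G u * ends v + deg G v * ends u
      both u v = ends u * ends v
      pairwise : ∀ u v → w u v * (deg G′ u * deg G′ v) ≤ w u v * (deg G u * deg G v) + Δ * (mixed u v + both u v)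
      pairwise u v = begin
        w u v * (deg G′ u * deg G′ v)
          ≡⟨ cong₂ (λ x y → w u v * (x * y)) (deg′ u) (deg′ v) ⟩
        w u v * ((deg G u + ends u) * (deg G v + ends v))
          ≡⟨ expand (w u v) (deg G u) (ends u) (deg G v) (ends v) ⟩
        w u v * (deg G u * deg G v) + w u v * (mixed u v + both u v)
          ≤⟨ +-monoʳ-≤ _ (*-monoˡ-≤ (mixed u v + both u v) (distSq≤sq-diameter H f u v)) ⟩
        w u v * (deg G u * deg G v) + Δ * (mixed u v + both u v) ∎
        where
        expand : ∀ x du eu dv ev → x * ((du + eu) * (dv + ev)) ≡ x * (du * dv) + x * ((du * ev + dv * eu) + eu * ev)
        expand = solve-∀

-- Bounding the ratio λ(G′,H)/λ(G,H)

1+toℚ-≐ : ∀ m → 1ℚ ℚ.+ toℚ m ≐ suc m / 1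
1+toℚ-≐ m = ≐-rescale (≐-+ 1ℚ-≐ (toℚ-≐ m)) (regroup m) (s≤s z≤n)
  where
  regroup : ∀ m → (1 * 1 + m * 1) * 1 ≡ (1 + m) * (1 * 1)
  regroup = solve-∀

1+2/V-≐ : ∀ V → 1 ≤ V → 1ℚ ℚ.+ (toℚ 2 ÷ℚ toℚ V) ≐ V + 2 / V
1+2/V-≐ V 1≤V = ≐-rescale (≐-+ 1ℚ-≐ (toℚ÷toℚ-≐ 2 V 1≤V)) (regroup V) 1≤V
  where
  regroup : ∀ V → (1 * V + 2 * 1) * V ≡ (V + 2) * (1 * V)
  regroup = solve-∀

*-⊔-lub : ∀ k x y z → k ℚ.* x ℚ.≤ z → k ℚ.* y ℚ.≤ z → k ℚ.* (x ℚ.⊔ y) ℚ.≤ z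
*-⊔-lub k x y z kx≤z ky≤z with ℚP.≤-total x y
... | inj₁ x≤y = subst (λ m → k ℚ.* m ℚ.≤ z) (sym (ℚP.p≤q⇒p⊔q≡q x≤y)) ky≤z
... | inj₂ y≤x = subst (λ m → k ℚ.* m ℚ.≤ z) (sym (ℚP.p≥q⇒p⊔q≡p y≤x)) kx≤z

module _ {V N D N′ D′ : ℕ} {ℓ ℓ′ : ℚ} (1≤V : 1 ≤ V) (1≤N : 1 ≤ N)
         (ℓ≐ : ℓ ≐ V * N / D) (ℓ′≐ : ℓ′ ≐ (V + 2) * N′ / D′) where

  private
    ratio≐ : ℓ′ ÷ℚ ℓ ≐ (V + 2) * N′ * D / (D′ * (V * N))
    ratio≐ = ≐-÷ ℓ′≐ ℓ≐ (*-mono-≤ 1≤V 1≤N)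

    regroupₗ : ∀ V N′ D q → (V + 2) * N′ * D * (V * q) ≡ ((V + 2) * V) * (q * (N′ * D))
    regroupₗ = solve-∀

    regroupᵣ : ∀ V p D′ N → (V + 2) * p * (D′ * (V * N)) ≡ ((V + 2) * V) * (p * (D′ * N))
    regroupᵣ = solve-∀

  ratio≤[1+2/V]* : ∀ {x p q} → x ≐ p / q → q * (N′ * D) ≤ p * (D′ * N) →
    ℓ′ ÷ℚ ℓ ℚ.≤ (1ℚ ℚ.+ (toℚ 2 ÷ℚ toℚ V)) ℚ.* x
  ratio≤[1+2/V]* {x} {p} {q} x≐ q*N′D≤p*D′N = ≐-≤ ratio≐ (≐-* (1+2/V-≐ V 1≤V) x≐) (begin
    (V + 2) * N′ * D * (V * q)          ≡⟨ regroupₗ V N′ D q ⟩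
    ((V + 2) * V) * (q * (N′ * D))      ≤⟨ *-monoʳ-≤ ((V + 2) * V) q*N′D≤p*D′N ⟩
    ((V + 2) * V) * (p * (D′ * N))      ≡⟨ regroupᵣ V p D′ N ⟨
    (V + 2) * p * (D′ * (V * N))        ∎)
    where open ≤-Reasoning

  [1+2/V]*≤ratio : ∀ {x p q} → x ≐ p / q → p * (D′ * N) ≤ q * (N′ * D) →
    (1ℚ ℚ.+ (toℚ 2 ÷ℚ toℚ V)) ℚ.* x ℚ.≤ ℓ′ ÷ℚ ℓ
  [1+2/V]*≤ratio {x} {p} {q} x≐ p*D′N≤q*N′D = ≐-≤ (≐-* (1+2/V-≐ V 1≤V) x≐) ratio≐ (begin
    (V + 2) * p * (D′ * (V * N))        ≡⟨ regroupᵣ V p D′ N ⟩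
    ((V + 2) * V) * (p * (D′ * N))      ≤⟨ *-monoʳ-≤ ((V + 2) * V) p*D′N≤q*N′D ⟩
    ((V + 2) * V) * (q * (N′ * D))      ≡⟨ regroupₗ V N′ D q ⟨
    (V + 2) * N′ * D * (V * q)          ∎)
    where open ≤-Reasoning

-- In the next three lemmas N/D and N′/D′ are numerator and denominator of the minimisers f₀ for
-- G and g₀ for G′, D₁ the denominator of f₀ for G′ and D₂ that of g₀ for G.

cross-upper : ∀ Δ N D N′ D′ {N₁ D₁} → 1 ≤ N → D ≤ D₁ → N′ * D₁ ≤ N₁ * D′ → N₁ ≤ N + Δ →
  1 * (N′ * D) ≤ suc Δ * (D′ * N)
cross-upper Δ N D N′ D′ {N₁} {D₁} 1≤N D≤D₁ g₀-beats-f₀ N₁≤N+Δ = begin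
  1 * (N′ * D)         ≡⟨ *-identityˡ (N′ * D) ⟩
  N′ * D               ≤⟨ *-monoʳ-≤ N′ D≤D₁ ⟩
  N′ * D₁              ≤⟨ g₀-beats-f₀ ⟩
  N₁ * D′              ≤⟨ *-monoˡ-≤ D′ (≤-trans N₁≤N+Δ (+-monoʳ-≤ N (m≤m*n Δ N {{ℕ.>-nonZero 1≤N}}))) ⟩
  (N + Δ * N) * D′     ≡⟨ regroup N Δ D′ ⟩
  suc Δ * (D′ * N)     ∎
  where
  open ≤-Reasoning
  regroup : ∀ N Δ D′ → (N + Δ * N) * D′ ≡ (1 + Δ) * (D′ * N)
  regroup = solve-∀

cross-lower : ∀ W X N D N′ D′ D₂ → D′ ≤ D₂ + X → W ≤ D₂ → N * D₂ ≤ N′ * D →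
  W * (D′ * N) ≤ (W + X) * (N′ * D)
cross-lower W X N D N′ D′ D₂ D′≤D₂+X W≤D₂ f₀-beats-g₀ = begin
  W * (D′ * N)                  ≤⟨ *-monoʳ-≤ W (*-monoˡ-≤ N D′≤D₂+X) ⟩
  W * ((D₂ + X) * N)            ≡⟨ expand W D₂ X N ⟩
  (W * D₂ + W * X) * N          ≤⟨ *-monoˡ-≤ N (+-monoʳ-≤ (W * D₂) (*-monoˡ-≤ X W≤D₂)) ⟩
  (W * D₂ + D₂ * X) * N         ≡⟨ collect W D₂ X N ⟩
  (W + X) * (N * D₂)            ≤⟨ *-monoʳ-≤ (W + X) f₀-beats-g₀ ⟩
  (W + X) * (N′ * D)            ∎
  where
  open ≤-Reasoning
  expand : ∀ W D₂ X N → W * ((D₂ + X) * N) ≡ (W * D₂ + W * X) * N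
  expand = solve-∀
  collect : ∀ W D₂ X N → (W * D₂ + D₂ * X) * N ≡ (W + X) * (N * D₂)
  collect = solve-∀

cross-lower-¼ : ∀ N D N′ D′ D₂ → D′ ≤ 4 * D₂ → N * D₂ ≤ N′ * D → 1 * (D′ * N) ≤ 4 * (N′ * D)
cross-lower-¼ N D N′ D′ D₂ D′≤4D₂ f₀-beats-g₀ = begin
  1 * (D′ * N)      ≡⟨ *-identityˡ (D′ * N) ⟩
  D′ * N            ≤⟨ *-monoˡ-≤ N D′≤4D₂ ⟩
  4 * D₂ * N        ≡⟨ *-assoc 4 D₂ N ⟩
  4 * (D₂ * N)      ≡⟨ cong (4 *_) (*-comm D₂ N) ⟩
  4 * (N * D₂)      ≤⟨ *-monoʳ-≤ 4 f₀-beats-g₀ ⟩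
  4 * (N′ * D)      ∎
  where open ≤-Reasoning

module LambdaRatio {n k} (G G′ : Graph n) (H : Graph k) (a b : Fin n)
  (a≢b : a ≢ b) (ab∉G : adj G a b ≡ false) (G′≡G+ab : ∀ u v → adj G′ u v ≡ addEdgeAdj G a b u v)
  (conn : Connected G) (deg≥1 : ∀ u → 1 ≤ deg G u) (6≤V : 6 ≤ vol G)
  (f₁ : Fin n → Fin k) (f₁-admissible : Admissible G H f₁)
  {ℓ ℓ′ : ℚ} (ℓ-λ : IsLambda G H ℓ) (ℓ′-λ : IsLambda G′ H ℓ′) where

  open AddEdge G G′ a b a≢b ab∉G G′≡G+ab

  private
    f₀ g₀ : Fin n → Fin k
    f₀ = proj₁ (minimizer-exists G H f₁ f₁-admissible)
    g₀ = proj₁ (minimizer-exists G′ H f₁ (admissible⇒admissible′ H f₁ f₁-admissible))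

    N D N′ D′ D₂ : ℕ
    N  = numer G H f₀
    D  = denom G H f₀
    N′ = numer G′ H g₀
    D′ = denom G′ H g₀
    D₂ = denom G H g₀

    f₀-min : IsMinimizer G H f₀
    f₀-min = proj₂ (minimizer-exists G H f₁ f₁-admissible)

    g₀-min : IsMinimizer G′ H g₀
    g₀-min = proj₂ (minimizer-exists G′ H f₁ (admissible⇒admissible′ H f₁ f₁-admissible))

    1≤V : 1 ≤ vol G
    1≤V = ≤-trans (s≤s z≤n) 6≤V

    1≤V∸1 : 1 ≤ vol G ∸ 1
    1≤V∸1 = ∸-monoˡ-≤ 1 (≤-trans (s≤s (s≤s z≤n)) 6≤V)

    1≤N : 1 ≤ numer G H f₀
    1≤N = let _ , _ , f₀-nonconstant = denom≢0⇒nonconstant G H f₀ (proj₁ f₀-min)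
          in nonconstant⇒numer≥1 G H f₀ conn f₀-nonconstant

    V∸1≤D₂ : vol G ∸ 1 ≤ denom G H g₀
    V∸1≤D₂ = let _ , _ , g₀-nonconstant = denom≢0⇒nonconstant G′ H g₀ (proj₁ g₀-min)
             in nonconstant⇒vol∸1≤denom G H g₀ deg≥1 g₀-nonconstant

    f₀-admissible′ : Admissible G′ H f₀
    f₀-admissible′ = admissible⇒admissible′ H f₀ (proj₁ f₀-min)

    g₀-admissible : Admissible G H g₀
    g₀-admissible = n>0⇒n≢0 (≤-trans 1≤V∸1 V∸1≤D₂)

    ℓ≐ : ℓ ≐ vol G * numer G H f₀ / denom G H f₀
    ℓ≐ = subst (_≐ vol G * numer G H f₀ / denom G H f₀)
               (IsLambda-unique G H (minimizer⇒IsLambda G H f₀-min) ℓ-λ) (R-≐ G H f₀ (proj₁ f₀-min))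

    ℓ′≐ : ℓ′ ≐ (vol G + 2) * numer G′ H g₀ / denom G′ H g₀
    ℓ′≐ = subst₂ (λ ℓ′ V′ → ℓ′ ≐ V′ * numer G′ H g₀ / denom G′ H g₀)
                 (IsLambda-unique G′ H (minimizer⇒IsLambda G′ H g₀-min) ℓ′-λ) vol′ (R-≐ G′ H g₀ (proj₁ g₀-min))

    g₀-beats-f₀-in-G′ : numer G′ H g₀ * denom G′ H f₀ ≤ numer G′ H f₀ * denom G′ H g₀
    g₀-beats-f₀-in-G′ = R-≤⇒cross G′ H (subst (1 ≤_) (sym vol′) (≤-trans 1≤V (m≤m+n (vol G) 2)))
                          (proj₁ g₀-min) f₀-admissible′ (proj₂ g₀-min f₀ f₀-admissible′)

    f₀-beats-g₀-in-G : numer G H f₀ * denom G H g₀ ≤ numer G′ H g₀ * denom G H f₀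
    f₀-beats-g₀-in-G =
      ≤-trans (R-≤⇒cross G H 1≤V (proj₁ f₀-min) g₀-admissible (proj₂ f₀-min g₀ g₀-admissible))
              (*-monoˡ-≤ (denom G H f₀) (numer≤numer′ H g₀))

  upper : ℓ′ ÷ℚ ℓ ℚ.≤ (1ℚ ℚ.+ (toℚ 2 ÷ℚ toℚ (vol G))) ℚ.* (1ℚ ℚ.+ toℚ (sq (diameter H)))
  upper = ratio≤[1+2/V]* 1≤V 1≤N ℓ≐ ℓ′≐ (1+toℚ-≐ (sq (diameter H)))
            (cross-upper (sq (diameter H)) N D N′ D′ 1≤N
               (denom≤denom′ H f₀) g₀-beats-f₀-in-G′ (numer′≤numer+Δ H f₀))

  lower : (1ℚ ℚ.+ (toℚ 2 ÷ℚ toℚ (vol G)))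
          ℚ.* ((toℚ (vol G ∸ 1) ÷ℚ toℚ ((vol G ∸ 1) ℕ.+ sq (diameter H) ℕ.* (2 ℕ.* vol G ℕ.+ 1)))
               ℚ.⊔ (toℚ 1 ÷ℚ toℚ 4))
          ℚ.≤ ℓ′ ÷ℚ ℓ
  lower = *-⊔-lub (1ℚ ℚ.+ (toℚ 2 ÷ℚ toℚ (vol G)))
                  (toℚ (vol G ∸ 1) ÷ℚ toℚ ((vol G ∸ 1) ℕ.+ sq (diameter H) ℕ.* (2 ℕ.* vol G ℕ.+ 1)))
                  (toℚ 1 ÷ℚ toℚ 4) (ℓ′ ÷ℚ ℓ)
    ([1+2/V]*≤ratio 1≤V 1≤N ℓ≐ ℓ′≐
      (toℚ÷toℚ-≐ (vol G ∸ 1) _ (≤-trans 1≤V∸1 (m≤m+n (vol G ∸ 1) _)))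
      (cross-lower (vol G ∸ 1) (sq (diameter H) * (2 * vol G + 1)) N D N′ D′ D₂
         (denom′≤denom+Δ*[2vol+1] H g₀) V∸1≤D₂ f₀-beats-g₀-in-G))
    ([1+2/V]*≤ratio 1≤V 1≤N ℓ≐ ℓ′≐ (toℚ÷toℚ-≐ 1 4 (s≤s z≤n))
      (cross-lower-¼ N D N′ D′ D₂ (denom′≤4*denom H g₀ deg≥1) f₀-beats-g₀-in-G))

two-valued : ∀ {n k} → Fin (suc (suc n)) → Fin (suc (suc k))
two-valued zero    = zero
two-valued (suc _) = suc zero

two-valued-admissible : ∀ {n k} (G : Graph (suc (suc n))) (H : Graph (suc (suc k))) →
  (∀ u → 1 ≤ deg G u) → Admissible G H two-valued
two-valued-admissible {n} {k} G H deg≥1 = n>0⇒n≢0 (≤-trans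
  (*-mono-≤ (distSq≥1 H (two-valued {n} {k}) {zero} {suc zero} (λ ())) (*-mono-≤ (deg≥1 zero) (deg≥1 (suc zero))))
  (term≤sumPairs (λ u v → distSq H (two-valued {n} {k}) u v * (deg G u * deg G v)) {zero} {suc zero} (s≤s z≤n)))

theorem6p1 : ∀ {n k} (G G′ : Graph n) (H : Graph k) (a b : Fin n)
  → Connected G → 6 ≤ vol G
  → a ≢ b → adj G a b ≡ false
  → (∀ u v → adj G′ u v ≡ addEdgeAdj G a b u v)
  → Connected H → 2 ≤ k
  → Σ ℚ (IsLambda G H) × Σ ℚ (IsLambda G′ H)
    × (∀ ℓ ℓ′ → IsLambda G H ℓ → IsLambda G′ H ℓ′
        → (ℓ′ ÷ℚ ℓ) ℚ.≤ ((1ℚ ℚ.+ (toℚ 2 ÷ℚ toℚ (vol G))) ℚ.* (1ℚ ℚ.+ toℚ (sq (diameter H))))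
        × ((1ℚ ℚ.+ (toℚ 2 ÷ℚ toℚ (vol G)))
            ℚ.* ((toℚ (vol G ∸ 1) ÷ℚ toℚ ((vol G ∸ 1) ℕ.+ sq (diameter H) ℕ.* (2 ℕ.* vol G ℕ.+ 1)))
                 ℚ.⊔ (toℚ 1 ÷ℚ toℚ 4))
          ℚ.≤ (ℓ′ ÷ℚ ℓ)))
theorem6p1 {zero}  G G′ H () b
theorem6p1 {suc zero} G G′ H zero zero conn 6≤V a≢b = ⊥-elim (a≢b refl)
theorem6p1 {suc (suc n)} {suc (suc k)} G G′ H a b conn 6≤V a≢b ab∉G G′≡G+ab _ (s≤s (s≤s z≤n)) =
    lambda-exists G H two-valued admissible
  , lambda-exists G′ H two-valued (admissible⇒admissible′ H two-valued admissible)
  , λ ℓ ℓ′ ℓ-λ ℓ′-λ →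
      let open LambdaRatio G G′ H a b a≢b ab∉G G′≡G+ab conn deg≥1 6≤V two-valued admissible ℓ-λ ℓ′-λ
      in upper , lower
  where
  open AddEdge G G′ a b a≢b ab∉G G′≡G+ab using (admissible⇒admissible′)

  deg≥1 : ∀ u → 1 ≤ deg G u
  deg≥1 = connected⇒deg≥1 G conn

  admissible : Admissible G H two-valued
  admissible = two-valued-admissible G H deg≥1
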